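{- Let $n\ge2$ be a natural number and let $\mathbb F_2$ be the free group on generators $\sigma,\tau$. Define $\gamma_0:=\sigma^{n-1}$, $\gamma_1:=\tau\sigma^{n-2}$, and $\gamma_i:=\sigma^{ -i+1}\tau\sigma^{i-2}$ for $2\le i<n$. If $\omega\in\mathbb F_2$ is a reduced word beginning with $\tau$, then there is a partition $\mathbb F_2=A_0\sqcup B_0\sqcup\dots\sqcup A_{n-1}\sqcup B_{n-1}$ into $2n$ sets such that $\sigma^{ -i+1}\in A_i$ for all $i<n$, $\omega\in A_1$, and $\gamma_i(B_i)=\mathbb F_2-A_i$ for all $i<n$.
   Context: Elements of $\mathbb F_2$ are identified with reduced words; for $\gamma\in\mathbb F_2$ and $E\subseteq\mathbb F_2$, $\gamma(E):=\{\gamma\beta:\beta\in E\}$. -}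

module Defs where

open import Data.Bool using (Bool; true; false; not; _∧_; T; if_then_else_)
open import Data.Unit using (tt)
open import Data.Nat using (ℕ; zero; suc; _∸_)
open import Data.Integer using (ℤ; +_; -[1+_]; _-_)
open import Data.Fin using (Fin; toℕ)
open import Data.List using (List; []; _∷_; _++_; replicate; foldr)
open import Data.Product using (Σ; _×_; _,_; proj₁)
open import Relation.Binary.PropositionalEquality using (_≡_; refl)

data Gen : Set where
  σ τ : Gen

-- A letter is a generator with an exponent sign: (g , true) = g, (g , false) = g⁻¹
Letter : Set
Letter = Gen × Bool

sameGen : Gen → Gen → Bool
sameGen σ σ = true
sameGen τ τ = true
sameGen _ _ = false

opp : Bool → Bool → Bool
opp true false = true
opp false true = true
opp _ _ = false

cancels : Letter → Letter → Bool
cancels (g , b) (h , c) = sameGen g h ∧ opp b c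

isReduced : List Letter → Bool
isReduced [] = true
isReduced (x ∷ []) = true
isReduced (x ∷ y ∷ w) = not (cancels x y) ∧ isReduced (y ∷ w)

F₂ : Set
F₂ = Σ (List Letter) (λ w → T (isReduced w))

consReduce : Letter → List Letter → List Letter
consReduce a [] = a ∷ []
consReduce a (b ∷ w) = if cancels a b then w else (a ∷ b ∷ w)

reduce : List Letter → List Letter
reduce = foldr consReduce []

private
  tailRed : ∀ b w → T (isReduced (b ∷ w)) → T (isReduced w)
  tailRed b [] _ = tt
  tailRed b (c ∷ w) p with not (cancels b c)
  ... | true = p

  consRed : ∀ a w → T (isReduced w) → T (isReduced (consReduce a w))
  consRed a [] _ = tt
  consRed a (b ∷ w) p = go (cancels a b) refl
    where
    go : (c : Bool) → cancels a b ≡ c → T (isReduced (if c then w else (a ∷ b ∷ w)))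
    go true _ = tailRed b w p
    go false e rewrite e = p

reduce-reduced : ∀ w → T (isReduced (reduce w))
reduce-reduced [] = tt
reduce-reduced (a ∷ w) = consRed a (reduce w) (reduce-reduced w)

⟦_⟧ : List Letter → F₂
⟦ w ⟧ = reduce w , reduce-reduced w

_·_ : F₂ → F₂ → F₂
x · y = ⟦ proj₁ x ++ proj₁ y ⟧

powW : Gen → ℤ → List Letter
powW g (+ k) = replicate k (g , true)
powW g -[1+ k ] = replicate (suc k) (g , false)

pow : Gen → ℤ → F₂
pow g k = ⟦ powW g k ⟧

γW : ℕ → ℕ → List Letter
γW n zero = powW σ (+ (n ∸ 1))
γW n (suc zero) = (τ , true) ∷ powW σ (+ (n ∸ 2))
γW n (suc (suc k)) = powW σ (+ 1 - + (suc (suc k))) ++ ((τ , true) ∷ powW σ (+ k))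

γ : (n : ℕ) → Fin n → F₂
γ n i = ⟦ γW n (toℕ i) ⟧

StartsWithτ : F₂ → Set
StartsWithτ (w , _) = Σ (List Letter) (λ v → w ≡ (τ , true) ∷ v)

-- A partition of F₂ into sets A_0, B_0, …, A_{n-1}, B_{n-1} is given by
-- a labelling p : F₂ → Fin n × Bool; A_i = p⁻¹(i,true), B_i = p⁻¹(i,false).
InA : {n : ℕ} → (F₂ → Fin n × Bool) → Fin n → F₂ → Set
InA p i x = p x ≡ (i , true)

InB : {n : ℕ} → (F₂ → Fin n × Bool) → Fin n → F₂ → Set
InB p i x = p x ≡ (i , false)

InImage : F₂ → (F₂ → Set) → F₂ → Set
InImage g E x = Σ F₂ (λ b → E b × (g · b) ≡ x)

module Submission where

-- The γ_i freely generate the kernel H of the map F₂ → ℤ/(n−1) sending σ and τ to −1, and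
-- Reidemeister–Schreier rewriting with coset representatives t_d = σ^(−d), 0 ≤ d ≤ n−2,
-- writes every x ∈ F₂ uniquely as h · t_d with h a reduced word in the γ_i. Put x into A_i
-- or B_i according as h begins with γ_i or γ_i⁻¹, except that the words h = γ_{d+1}^(−m),
-- h = 1 included, go into A_{d+1}. Multiplying by γ_i^(±1) on the left only multiplies h,
-- so γ_i(B_i) = F₂ − A_i is the usual ping-pong bookkeeping on reduced words, and
-- σ^(−i+1) = t_{i−1} (i ≥ 2), 1 = t_0, σ = γ_0 t_{n−2} and ω = γ_1 ⋯ land as required.

open import Defs
open import Data.Nat using (ℕ; _≤_)
open import Data.Integer using (+_; _-_)
open import Data.Fin using (Fin; toℕ)
open import Data.Bool using (Bool)
open import Data.Product using (Σ; _×_)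
open import Relation.Nullary using (¬_)
open import Relation.Binary.PropositionalEquality using (_≡_)
open import Function.Bundles using (_⇔_)

open import Data.Bool using (true; false; not; _∧_; T; if_then_else_)
import Data.Bool.Properties
open import Data.Bool.Properties using (not-involutive; not-¬; T-irrelevant; T-∧)
open import Data.Empty using (⊥-elim)
open import Data.Fin using (zero; suc)
open import Data.Fin.Properties using (toℕ<n)
open import Data.List using (List; []; _∷_; _++_; foldr; foldl; _?∷_; replicate)
open import Data.List.Properties using (++-identityʳ; foldr-++; foldl-++)
open import Data.List.Relation.Unary.All using (All; []; _∷_)
open import Data.Maybe using (Maybe; just; nothing; maybe′)
import Data.Maybe as Maybe
open import Data.Nat using (zero; suc; _+_; _<_; z≤n; s≤s; _≟_)
open import Data.Nat.Properties
  using (≤-refl; <⇒≤; <⇒≢; ≤∧≢⇒<; n<1+n; <-trans; <-irrefl; +-suc; +-identityʳ; m+n≤o⇒m≤o)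
open import Data.Product using (_,_; proj₁; proj₂; map₁)
open import Data.Product.Properties using (≡-dec)
open import Data.Sum using (_⊎_; inj₁; inj₂)
open import Data.Unit using (⊤; tt)
open import Function using (case_of_; id; _∘_)
open import Function.Bundles using (Equivalence; mk⇔)
open import Relation.Binary.Definitions using (DecidableEquality)
open import Relation.Binary.PropositionalEquality using (_≢_; refl; sym; trans; cong; cong₂; subst; module ≡-Reasoning)
open import Relation.Nullary using (yes; no; does)
open import Relation.Nullary.Decidable using (dec-true)

opp-not : ∀ b → opp b (not b) ≡ true
opp-not true = refl
opp-not false = refl

opp⇒≡not : ∀ b c → opp b c ≡ true → c ≡ not b
opp⇒≡not true false _ = refl
opp⇒≡not false true _ = refl

module FreeReduction {X : Set} (_≟ˣ_ : DecidableEquality X) where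

  Sym : Set
  Sym = X × Bool

  _⁻¹ : Sym → Sym
  (x , b) ⁻¹ = x , not b

  ⁻¹-involutive : ∀ a → (a ⁻¹) ⁻¹ ≡ a
  ⁻¹-involutive (x , b) = cong (x ,_) (not-involutive b)

  inverses : Sym → Sym → Bool
  inverses (x , b) (y , c) = does (x ≟ˣ y) ∧ opp b c

  inverses⇒≡⁻¹ : ∀ a b → inverses a b ≡ true → b ≡ a ⁻¹
  inverses⇒≡⁻¹ (x , b) (y , c) e with x ≟ˣ y
  ... | yes refl = cong (x ,_) (opp⇒≡not b c e)

  inverses-⁻¹ : ∀ a → inverses a (a ⁻¹) ≡ true
  inverses-⁻¹ (x , b) rewrite dec-true (x ≟ˣ x) refl = opp-not b

  HeadIsNot : Sym → List Sym → Set
  HeadIsNot c [] = ⊤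
  HeadIsNot c (a ∷ _) = a ≢ c

  Reduced : List Sym → Set
  Reduced [] = ⊤
  Reduced (a ∷ w) = HeadIsNot (a ⁻¹) w × Reduced w

  cons : Sym → List Sym → List Sym
  cons a [] = a ∷ []
  cons a (b ∷ w) = if inverses a b then w else a ∷ b ∷ w

  cons-⁻¹∷ : ∀ a w → cons a (a ⁻¹ ∷ w) ≡ w
  cons-⁻¹∷ a w rewrite inverses-⁻¹ a = refl

  cons-head : ∀ a w → HeadIsNot (a ⁻¹) w → cons a w ≡ a ∷ w
  cons-head a [] _ = refl
  cons-head a (b ∷ w) b≢a⁻¹ with inverses a b in e
  ... | true = ⊥-elim (b≢a⁻¹ (inverses⇒≡⁻¹ a b e))
  ... | false = refl

  _≟ˢ_ : DecidableEquality Sym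
  _≟ˢ_ = ≡-dec _≟ˣ_ Data.Bool.Properties._≟_

  headIsNot? : ∀ c w → (Σ (List Sym) λ w′ → w ≡ c ∷ w′) ⊎ HeadIsNot c w
  headIsNot? c [] = inj₂ tt
  headIsNot? c (a ∷ w) with a ≟ˢ c
  ... | yes refl = inj₁ (w , refl)
  ... | no a≢c = inj₂ a≢c

  cons-reduced : ∀ a w → Reduced w → Reduced (cons a w)
  cons-reduced a w r with headIsNot? (a ⁻¹) w
  ... | inj₁ (w′ , refl) rewrite cons-⁻¹∷ a w′ = proj₂ r
  ... | inj₂ h rewrite cons-head a w h = h , r

  cons-cons-⁻¹ : ∀ a w → Reduced w → cons a (cons (a ⁻¹) w) ≡ w
  cons-cons-⁻¹ a w r with headIsNot? ((a ⁻¹) ⁻¹) w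
  ... | inj₂ h rewrite cons-head (a ⁻¹) w h = cons-⁻¹∷ a w
  ... | inj₁ (w′ , refl) rewrite cons-⁻¹∷ (a ⁻¹) w′ | ⁻¹-involutive a =
    cons-head a w′ (subst (λ c → HeadIsNot (c ⁻¹) w′) (⁻¹-involutive a) (proj₁ r))

  replicate-reduced : ∀ a r → Reduced (replicate r a)
  replicate-reduced a zero = tt
  replicate-reduced (x , b) (suc zero) = tt , tt
  replicate-reduced (x , b) (suc (suc r)) = (λ e → not-¬ {b} refl (cong proj₂ e)) , replicate-reduced (x , b) (suc r)

  reduceOnto : List Sym → List Sym → List Sym
  reduceOnto w y = foldr cons y w

  normalForm : List Sym → List Sym
  normalForm w = reduceOnto w []

  inverseWord : List Sym → List Sym
  inverseWord [] = []
  inverseWord (a ∷ w) = inverseWord w ++ a ⁻¹ ∷ []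

  reduceOnto-reduced : ∀ w y → Reduced y → Reduced (reduceOnto w y)
  reduceOnto-reduced [] y r = r
  reduceOnto-reduced (a ∷ w) y r = cons-reduced a _ (reduceOnto-reduced w y r)

  reduceOnto-++ : ∀ u v y → reduceOnto (u ++ v) y ≡ reduceOnto u (reduceOnto v y)
  reduceOnto-++ u v y = foldr-++ cons y u v

  normalForm-reduced : ∀ y → Reduced y → normalForm y ≡ y
  normalForm-reduced [] _ = refl
  normalForm-reduced (a ∷ y) (h , r) = trans (cong (cons a) (normalForm-reduced y r)) (cons-head a y h)

  reduceOnto-cons : ∀ a u y → Reduced y → reduceOnto (cons a u) y ≡ cons a (reduceOnto u y)
  reduceOnto-cons a u y r with headIsNot? (a ⁻¹) u
  ... | inj₂ h rewrite cons-head a u h = refl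
  ... | inj₁ (u′ , refl) rewrite cons-⁻¹∷ a u′ =
    sym (cons-cons-⁻¹ a _ (reduceOnto-reduced u′ y r))

  reduceOnto-normalForm : ∀ w y → Reduced y → reduceOnto (normalForm w) y ≡ reduceOnto w y
  reduceOnto-normalForm [] y r = refl
  reduceOnto-normalForm (a ∷ w) y r =
    trans (reduceOnto-cons a (normalForm w) y r) (cong (cons a) (reduceOnto-normalForm w y r))

  reduceOnto-inverseWord : ∀ w y → Reduced y → reduceOnto w (reduceOnto (inverseWord w) y) ≡ y
  reduceOnto-inverseWord [] y r = refl
  reduceOnto-inverseWord (a ∷ w) y r
    rewrite reduceOnto-++ (inverseWord w) (a ⁻¹ ∷ []) y
          | reduceOnto-inverseWord w (cons (a ⁻¹) y) (cons-reduced (a ⁻¹) y r) = cons-cons-⁻¹ a y r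

  cons? : Maybe Sym → List Sym → List Sym
  cons? = maybe′ cons id

  cons?-reduceOnto : ∀ m e r → cons? m (reduceOnto e r) ≡ reduceOnto (m ?∷ e) r
  cons?-reduceOnto nothing e r = refl
  cons?-reduceOnto (just u) e r = refl

  inverseWord-?∷ : ∀ m e → inverseWord (m ?∷ e) ≡ inverseWord e ++ (Maybe.map _⁻¹ m ?∷ [])
  inverseWord-?∷ nothing e = sym (++-identityʳ (inverseWord e))
  inverseWord-?∷ (just u) e = refl

  cons?-⁻¹ : ∀ m r → cons? m (Maybe.map _⁻¹ m ?∷ r) ≡ r
  cons?-⁻¹ nothing r = refl
  cons?-⁻¹ (just u) r = cons-⁻¹∷ u r

  ?∷-++ : ∀ (m : Maybe Sym) e r → (m ?∷ e) ++ r ≡ m ?∷ (e ++ r)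
  ?∷-++ nothing e r = refl
  ?∷-++ (just u) e r = refl

  isNegPower : X → List Sym → Bool
  isNegPower x₀ [] = true
  isNegPower x₀ ((x , b) ∷ h) = not b ∧ does (x ≟ˣ x₀) ∧ isNegPower x₀ h

  label : X → List Sym → Sym
  label x₀ [] = x₀ , true
  label x₀ (u ∷ h) = if isNegPower x₀ (u ∷ h) then (x₀ , true) else u

  isNegPower-∷⁺ : ∀ x₀ h → isNegPower x₀ h ≡ true → isNegPower x₀ ((x₀ , false) ∷ h) ≡ true
  isNegPower-∷⁺ x₀ h p rewrite dec-true (x₀ ≟ˣ x₀) refl = p

  isNegPower-∷⁻ : ∀ x₀ x h → isNegPower x₀ ((x , false) ∷ h) ≡ true → x ≡ x₀ × isNegPower x₀ h ≡ true
  isNegPower-∷⁻ x₀ x h p with x ≟ˣ x₀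
  ... | yes x≡x₀ = x≡x₀ , p

  label-negPower : ∀ x₀ h → isNegPower x₀ h ≡ true → label x₀ h ≡ (x₀ , true)
  label-negPower x₀ [] _ = refl
  label-negPower x₀ (u ∷ h) p rewrite p = refl

  label≡⁺-inv : ∀ x₀ h x → label x₀ h ≡ (x , true) →
            (x ≡ x₀ × isNegPower x₀ h ≡ true) ⊎ ¬ HeadIsNot (x , true) h
  label≡⁺-inv x₀ [] .x₀ refl = inj₁ (refl , refl)
  label≡⁺-inv x₀ (u ∷ h) x e with isNegPower x₀ (u ∷ h)
  label≡⁺-inv x₀ (u ∷ h) .x₀ refl | true = inj₁ (refl , refl)
  label≡⁺-inv x₀ (u ∷ h) x refl | false = inj₂ (λ u≢ → u≢ refl)

  label-cons⁺ : ∀ x₀ h x → Reduced h → label x₀ h ≡ (x , false) → label x₀ (cons (x , true) h) ≢ (x , true)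
  label-cons⁺ x₀ (u ∷ h) x (h≢ , _) e with isNegPower x₀ (u ∷ h) in p
  label-cons⁺ x₀ ((x , false) ∷ h) x (h≢ , _) refl | false rewrite cons-⁻¹∷ (x , true) h = λ e′ →
    case label≡⁺-inv x₀ h x e′ of λ where
      (inj₁ (refl , q)) → case trans (sym p) (isNegPower-∷⁺ x₀ h q) of λ ()
      (inj₂ ¬h) → ¬h h≢

  label-cons⁻ : ∀ x₀ h x → label x₀ h ≢ (x , true) → label x₀ (cons (x , false) h) ≡ (x , false)
  label-cons⁻ x₀ h x ≢⁺ with headIsNot? (x , true) h
  ... | inj₁ (h′ , refl) rewrite cons-⁻¹∷ (x , false) h′ = ⊥-elim (≢⁺ refl)
  ... | inj₂ nh rewrite cons-head (x , false) h nh with isNegPower x₀ ((x , false) ∷ h) in p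
  ... | false = refl
  ... | true with isNegPower-∷⁻ x₀ x h p
  ...   | refl , q = ⊥-elim (≢⁺ (label-negPower x₀ h q))

  label-All : ∀ {P : Sym → Set} x₀ h → P (x₀ , true) → All P h → P (label x₀ h)
  label-All x₀ [] p₀ _ = p₀
  label-All x₀ (u ∷ h) p₀ (pu ∷ _) with isNegPower x₀ (u ∷ h)
  ... | true = p₀
  ... | false = pu

_≟ᴳ_ : DecidableEquality Gen
σ ≟ᴳ σ = yes refl
σ ≟ᴳ τ = no λ ()
τ ≟ᴳ σ = no λ ()
τ ≟ᴳ τ = yes refl

module W = FreeReduction _≟ᴳ_
module H = FreeReduction _≟_

open W using (_⁻¹; Reduced; HeadIsNot; reduceOnto; inverseWord)

cancels≡inverses : ∀ a b → cancels a b ≡ W.inverses a b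
cancels≡inverses (σ , _) (σ , _) = refl
cancels≡inverses (σ , _) (τ , _) = refl
cancels≡inverses (τ , _) (σ , _) = refl
cancels≡inverses (τ , _) (τ , _) = refl

consReduce≡cons : ∀ a w → consReduce a w ≡ W.cons a w
consReduce≡cons a [] = refl
consReduce≡cons a (b ∷ w) rewrite cancels≡inverses a b = refl

reduce≡normalForm : ∀ w → reduce w ≡ W.normalForm w
reduce≡normalForm [] = refl
reduce≡normalForm (a ∷ w) = trans (consReduce≡cons a (reduce w)) (cong (W.cons a) (reduce≡normalForm w))

isReduced⇒Reduced : ∀ w → T (isReduced w) → Reduced w
isReduced⇒Reduced [] _ = tt
isReduced⇒Reduced (a ∷ []) _ = tt , tt
isReduced⇒Reduced (a ∷ b ∷ w) r = head-ok , isReduced⇒Reduced (b ∷ w) (proj₂ split)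
  where
  split = Equivalence.to T-∧ r
  head-ok : b ≢ a ⁻¹
  head-ok refl = subst (T ∘ not) (trans (cancels≡inverses a (a ⁻¹)) (W.inverses-⁻¹ a)) (proj₁ split)

reduced : (x : F₂) → Reduced (proj₁ x)
reduced (w , r) = isReduced⇒Reduced w r

F₂-ext : (x y : F₂) → proj₁ x ≡ proj₁ y → x ≡ y
F₂-ext (w , p) (.w , q) refl = cong (w ,_) (T-irrelevant p q)

word-· : (x y : F₂) → proj₁ (x · y) ≡ reduceOnto (proj₁ x) (proj₁ y)
word-· (u , _) (v , r) = begin
  reduce (u ++ v)                 ≡⟨ reduce≡normalForm (u ++ v) ⟩
  W.normalForm (u ++ v)           ≡⟨ W.reduceOnto-++ u v [] ⟩
  reduceOnto u (W.normalForm v)   ≡⟨ cong (reduceOnto u) (W.normalForm-reduced v (isReduced⇒Reduced v r)) ⟩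
  reduceOnto u v                  ∎
  where open ≡-Reasoning

word-⟦⟧· : ∀ u (y : F₂) → proj₁ (⟦ u ⟧ · y) ≡ reduceOnto u (proj₁ y)
word-⟦⟧· u y = begin
  proj₁ (⟦ u ⟧ · y)                       ≡⟨ word-· ⟦ u ⟧ y ⟩
  reduceOnto (reduce u) (proj₁ y)         ≡⟨ cong (λ v → reduceOnto v (proj₁ y)) (reduce≡normalForm u) ⟩
  reduceOnto (W.normalForm u) (proj₁ y)   ≡⟨ W.reduceOnto-normalForm u (proj₁ y) (reduced y) ⟩
  reduceOnto u (proj₁ y)                  ∎
  where open ≡-Reasoning

clamp : (m : ℕ) → ℕ → Fin (suc m)
clamp m zero = zero
clamp zero (suc i) = zero
clamp (suc m) (suc i) = suc (clamp m i)

clamp-toℕ : ∀ m (i : Fin (suc m)) → clamp m (toℕ i) ≡ i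
clamp-toℕ m zero = refl
clamp-toℕ (suc m) (suc i) = cong suc (clamp-toℕ m i)

toℕ-clamp : ∀ m i → i ≤ m → toℕ (clamp m i) ≡ i
toℕ-clamp m zero _ = refl
toℕ-clamp (suc m) (suc i) (s≤s i≤m) = cong suc (toℕ-clamp m i i≤m)

-- Reidemeister–Schreier rewriting for n = k + 2: the state j ≤ k stands for the coset H σ^(−j),
-- next a j is the coset of σ^(−j) a, and emit a j is the basis element σ^(−j) a σ^(next a j)
-- unless that is 1, with γ_i encoded as (i , true) and γ_i⁻¹ as (i , false).
module Schreier (k : ℕ) where

  decr : ℕ → ℕ
  decr zero = k
  decr (suc j) = j

  incr : ℕ → ℕ
  incr j with j ≟ k
  ... | yes _ = 0
  ... | no _ = suc j

  decr-incr : ∀ j → decr (incr j) ≡ j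
  decr-incr j with j ≟ k
  ... | yes refl = refl
  ... | no _ = refl

  incr-< : ∀ {j} → j < k → incr j ≡ suc j
  incr-< {j} j<k with j ≟ k
  ... | yes j≡k = ⊥-elim (<⇒≢ j<k j≡k)
  ... | no _ = refl

  incr-cases : ∀ j → incr j ≡ 0 ⊎ incr j ≡ suc j
  incr-cases j with j ≟ k
  ... | yes _ = inj₁ refl
  ... | no _ = inj₂ refl

  incr-decr : ∀ {j} → j ≤ k → incr (decr j) ≡ j
  incr-decr {zero} _ with k ≟ k
  ... | yes _ = refl
  ... | no k≢k = ⊥-elim (k≢k refl)
  incr-decr {suc j} = incr-<

  decr-≤ : ∀ {j} → j ≤ k → decr j ≤ k
  decr-≤ {zero} _ = ≤-refl
  decr-≤ {suc j} j<k = <⇒≤ j<k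

  incr-≤ : ∀ {j} → j ≤ k → incr j ≤ k
  incr-≤ {j} j≤k with j ≟ k
  ... | yes _ = z≤n
  ... | no j≢k = ≤∧≢⇒< j≤k j≢k

  next : Letter → ℕ → ℕ
  next (_ , true) = decr
  next (_ , false) = incr

  next-≤ : ∀ a {j} → j ≤ k → next a j ≤ k
  next-≤ (_ , true) = decr-≤
  next-≤ (_ , false) = incr-≤

  next-⁻¹ : ∀ a {j} → j ≤ k → next (a ⁻¹) (next a j) ≡ j
  next-⁻¹ (_ , true) = incr-decr
  next-⁻¹ (_ , false) {j} _ = decr-incr j

  emit⁺ : Gen → ℕ → Maybe H.Sym
  emit⁺ σ zero = just (0 , true)
  emit⁺ σ (suc _) = nothing
  emit⁺ τ zero = just (1 , true)
  emit⁺ τ (suc j) = just (suc (suc j) , true)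

  emit : Letter → ℕ → Maybe H.Sym
  emit (g , true) = emit⁺ g
  emit (g , false) j = Maybe.map H._⁻¹ (emit⁺ g (incr j))

  emit-⁻¹ : ∀ a {j} → j ≤ k → emit (a ⁻¹) (next a j) ≡ Maybe.map H._⁻¹ (emit a j)
  emit-⁻¹ (g , true) j≤k rewrite incr-decr j≤k = refl
  emit-⁻¹ (g , false) {j} _ with emit⁺ g (incr j)
  ... | nothing = refl
  ... | just u = cong just (sym (H.⁻¹-involutive u))

  schreier : ℕ → List Letter → List H.Sym
  schreier j [] = []
  schreier j (a ∷ w) = emit a j ?∷ schreier (next a j) w

  coset : ℕ → List Letter → ℕ
  coset = foldl (λ j a → next a j)

  origin : ℕ → ℕ × Gen
  origin zero = 0 , σ
  origin (suc zero) = 0 , τ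
  origin (suc (suc j)) = suc j , τ

  source : H.Sym → ℕ × Letter
  source (i , true) = proj₁ (origin i) , (proj₂ (origin i) , true)
  source (i , false) = decr (proj₁ (origin i)) , (proj₂ (origin i) , false)

  emit⁻-source : ∀ g i {u} → Maybe.map H._⁻¹ (emit⁺ g i) ≡ just u → source u ≡ (decr i , (g , false))
  emit⁻-source σ zero refl = refl
  emit⁻-source τ zero refl = refl
  emit⁻-source τ (suc i) refl = refl

  emit-source : ∀ a j {u} → emit a j ≡ just u → source u ≡ (j , a)
  emit-source (σ , true) zero refl = refl
  emit-source (τ , true) zero refl = refl
  emit-source (τ , true) (suc j) refl = refl
  emit-source (g , false) j e = trans (emit⁻-source g (incr j) e) (cong (_, (g , false)) (decr-incr j))

  emit-injective : ∀ a j c i {u} → emit a j ≡ just u → emit c i ≡ just u → (j , a) ≡ (i , c)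
  emit-injective a j c i e e′ = trans (sym (emit-source a j e)) (emit-source c i e′)

  silent⁻ : ∀ g i → Maybe.map H._⁻¹ (emit⁺ g i) ≡ nothing → g ≡ σ × i ≢ 0
  silent⁻ σ zero ()
  silent⁻ σ (suc i) _ = refl , λ ()
  silent⁻ τ zero ()
  silent⁻ τ (suc i) ()

  silent : ∀ a q → emit a q ≡ nothing →
           (a ≡ (σ , true) × Σ ℕ λ q′ → q ≡ suc q′) ⊎ (a ≡ (σ , false) × next a q ≡ suc q)
  silent (σ , true) zero ()
  silent (σ , true) (suc q) _ = inj₁ (refl , q , refl)
  silent (τ , true) zero ()
  silent (τ , true) (suc q) ()
  silent (g , false) q e with silent⁻ g (incr q) e | incr-cases q
  ... | refl , incr≢0 | inj₁ incr≡0 = ⊥-elim (incr≢0 incr≡0)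
  ... | refl , _ | inj₂ incr≡suc = inj₂ (refl , incr≡suc)

  -- Before its first emission a reduced word reads a run of σ's (the state decreases) or of
  -- σ⁻¹'s (the state increases), so it cannot come back to state j reading the letter c.
  NoReturn : ℕ → Letter → ℕ → List Letter → Set
  NoReturn j c q y = (q ≡ j × HeadIsNot c y) ⊎ (q < j × HeadIsNot (σ , false) y) ⊎ (j < q × HeadIsNot (σ , true) y)

  noReturn-σ : ∀ {j c q y} → NoReturn j c (suc q) ((σ , true) ∷ y) → HeadIsNot (σ , false) y → NoReturn j c q y
  noReturn-σ (inj₁ (refl , _)) h = inj₂ (inj₁ (n<1+n _ , h))
  noReturn-σ (inj₂ (inj₁ (q<j , _))) h = inj₂ (inj₁ (<-trans (n<1+n _) q<j , h))
  noReturn-σ (inj₂ (inj₂ (_ , h≢σ))) _ = ⊥-elim (h≢σ refl)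

  noReturn-σ⁻¹ : ∀ {j c q y} → NoReturn j c q ((σ , false) ∷ y) → HeadIsNot (σ , true) y → NoReturn j c (suc q) y
  noReturn-σ⁻¹ (inj₁ (refl , _)) h = inj₂ (inj₂ (n<1+n _ , h))
  noReturn-σ⁻¹ (inj₂ (inj₁ (_ , h≢σ⁻¹))) _ = ⊥-elim (h≢σ⁻¹ refl)
  noReturn-σ⁻¹ (inj₂ (inj₂ (j<q , _))) h = inj₂ (inj₂ (<-trans j<q (n<1+n _) , h))

  noReturn-here : ∀ j c q a y → NoReturn j c q (a ∷ y) → (q , a) ≢ (j , c)
  noReturn-here j c .j .c y (inj₁ (_ , c≢c)) refl = c≢c refl
  noReturn-here j c .j .c y (inj₂ (inj₁ (j<j , _))) refl = <-irrefl refl j<j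
  noReturn-here j c .j .c y (inj₂ (inj₂ (j<j , _))) refl = <-irrefl refl j<j

  first-emission-≢ : ∀ {j c w} → emit c j ≡ just w →
                     ∀ q y → Reduced y → NoReturn j c q y → H.HeadIsNot w (schreier q y)
  first-emission-≢ ew q [] _ _ = tt
  first-emission-≢ {j} {c} ew q (a ∷ y) (h , r) nr with emit a q in e
  ... | just v = λ { refl → noReturn-here j c q a y nr (emit-injective a q c j e ew) }
  ... | nothing with silent a q e
  ...   | inj₁ (refl , q′ , refl) = first-emission-≢ ew q′ y r (noReturn-σ nr h)
  ...   | inj₂ (refl , next≡suc) rewrite next≡suc = first-emission-≢ ew (suc q) y r (noReturn-σ⁻¹ nr h)

  emit-⁻¹-just : ∀ a {q u} → q ≤ k → emit a q ≡ just u → emit (a ⁻¹) (next a q) ≡ just (u H.⁻¹)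
  emit-⁻¹-just a q≤k e = trans (emit-⁻¹ a q≤k) (cong (Maybe.map H._⁻¹) e)

  emission-not-cancelled : ∀ a {q u} y → q ≤ k → Reduced (a ∷ y) → emit a q ≡ just u →
                           H.HeadIsNot (u H.⁻¹) (schreier (next a q) y)
  emission-not-cancelled a {q} y q≤k (h , r) e =
    first-emission-≢ (emit-⁻¹-just a q≤k e) (next a q) y r (inj₁ (refl , h))

  schreier-reduced : ∀ q y → q ≤ k → Reduced y → H.Reduced (schreier q y)
  schreier-reduced q [] _ _ = tt
  schreier-reduced q (a ∷ y) q≤k (h , r) with emit a q in e
  ... | nothing = schreier-reduced (next a q) y (next-≤ a q≤k) r
  ... | just u = emission-not-cancelled a y q≤k (h , r) e , schreier-reduced (next a q) y (next-≤ a q≤k) r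

  schreier-cons : ∀ a q y → q ≤ k → Reduced y →
                  schreier q (W.cons a y) ≡ H.cons? (emit a q) (schreier (next a q) y)
  schreier-cons a q y q≤k r with W.headIsNot? (a ⁻¹) y
  ... | inj₁ (y′ , refl)
    rewrite W.cons-⁻¹∷ a y′ | next-⁻¹ a q≤k | emit-⁻¹ a q≤k = sym (H.cons?-⁻¹ (emit a q) (schreier q y′))
  ... | inj₂ h rewrite W.cons-head a y h with emit a q in e
  ...   | nothing = refl
  ...   | just u = sym (H.cons-head u _ (emission-not-cancelled a y q≤k (h , r) e))

  coset-cons : ∀ a q y → q ≤ k → coset q (W.cons a y) ≡ coset (next a q) y
  coset-cons a q y q≤k with W.headIsNot? (a ⁻¹) y
  ... | inj₁ (y′ , refl) rewrite W.cons-⁻¹∷ a y′ | next-⁻¹ a q≤k = refl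
  ... | inj₂ h rewrite W.cons-head a y h = refl

  schreier-reduceOnto : ∀ w q y → q ≤ k → Reduced y →
                        schreier q (reduceOnto w y) ≡ H.reduceOnto (schreier q w) (schreier (coset q w) y)
  schreier-reduceOnto [] q y _ _ = refl
  schreier-reduceOnto (a ∷ w) q y q≤k r = begin
    schreier q (W.cons a (reduceOnto w y))
      ≡⟨ schreier-cons a q _ q≤k (W.reduceOnto-reduced w y r) ⟩
    H.cons? (emit a q) (schreier (next a q) (reduceOnto w y))
      ≡⟨ cong (H.cons? (emit a q)) (schreier-reduceOnto w (next a q) y (next-≤ a q≤k) r) ⟩
    H.cons? (emit a q) (H.reduceOnto (schreier (next a q) w) (schreier (coset (next a q) w) y))
      ≡⟨ H.cons?-reduceOnto (emit a q) _ _ ⟩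
    H.reduceOnto (schreier q (a ∷ w)) (schreier (coset q (a ∷ w)) y) ∎
    where open ≡-Reasoning

  coset-reduceOnto : ∀ w q y → q ≤ k → coset q (reduceOnto w y) ≡ coset (coset q w) y
  coset-reduceOnto [] q y _ = refl
  coset-reduceOnto (a ∷ w) q y q≤k =
    trans (coset-cons a q (reduceOnto w y) q≤k) (coset-reduceOnto w (next a q) y (next-≤ a q≤k))

  schreier-++ : ∀ u v q → schreier q (u ++ v) ≡ schreier q u ++ schreier (coset q u) v
  schreier-++ [] v q = refl
  schreier-++ (a ∷ u) v q =
    trans (cong (emit a q ?∷_) (schreier-++ u v (next a q))) (sym (H.?∷-++ (emit a q) _ _))

  coset-inverseWord : ∀ w q → q ≤ k → coset (coset q w) (inverseWord w) ≡ q
  coset-inverseWord [] q _ = refl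
  coset-inverseWord (a ∷ w) q q≤k = begin
    coset (coset (next a q) w) (inverseWord w ++ a ⁻¹ ∷ [])
      ≡⟨ foldl-++ _ _ (inverseWord w) (a ⁻¹ ∷ []) ⟩
    next (a ⁻¹) (coset (coset (next a q) w) (inverseWord w))
      ≡⟨ cong (next (a ⁻¹)) (coset-inverseWord w (next a q) (next-≤ a q≤k)) ⟩
    next (a ⁻¹) (next a q)
      ≡⟨ next-⁻¹ a q≤k ⟩
    q ∎
    where open ≡-Reasoning

  schreier-inverseWord : ∀ w q → q ≤ k → schreier (coset q w) (inverseWord w) ≡ H.inverseWord (schreier q w)
  schreier-inverseWord [] q _ = refl
  schreier-inverseWord (a ∷ w) q q≤k = begin
    schreier c (inverseWord w ++ a ⁻¹ ∷ [])
      ≡⟨ schreier-++ (inverseWord w) (a ⁻¹ ∷ []) c ⟩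
    schreier c (inverseWord w) ++ (emit (a ⁻¹) (coset c (inverseWord w)) ?∷ [])
      ≡⟨ cong₂ (λ h j → h ++ (emit (a ⁻¹) j ?∷ []))
               (schreier-inverseWord w (next a q) q′≤k) (coset-inverseWord w (next a q) q′≤k) ⟩
    H.inverseWord (schreier (next a q) w) ++ (emit (a ⁻¹) (next a q) ?∷ [])
      ≡⟨ cong (λ m → H.inverseWord (schreier (next a q) w) ++ (m ?∷ [])) (emit-⁻¹ a q≤k) ⟩
    H.inverseWord (schreier (next a q) w) ++ (Maybe.map H._⁻¹ (emit a q) ?∷ [])
      ≡⟨ H.inverseWord-?∷ (emit a q) _ ⟨
    H.inverseWord (schreier q (a ∷ w)) ∎
    where
    open ≡-Reasoning
    c = coset (next a q) w
    q′≤k = next-≤ a q≤k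

  Bounded : H.Sym → Set
  Bounded u = proj₁ u ≤ suc k

  emit⁺-bounded : ∀ g q {u} → q ≤ k → emit⁺ g q ≡ just u → Bounded u
  emit⁺-bounded σ zero _ refl = z≤n
  emit⁺-bounded τ zero _ refl = s≤s z≤n
  emit⁺-bounded τ (suc q) q<k refl = s≤s q<k

  emit-bounded : ∀ a {q u} → q ≤ k → emit a q ≡ just u → Bounded u
  emit-bounded (g , true) = emit⁺-bounded g _
  emit-bounded (g , false) {q} q≤k e with emit⁺ g (incr q) in e′
  emit-bounded (g , false) {q} q≤k refl | just v = emit⁺-bounded g (incr q) (incr-≤ q≤k) e′

  schreier-bounded : ∀ w q → q ≤ k → All Bounded (schreier q w)
  schreier-bounded [] q _ = []
  schreier-bounded (a ∷ w) q q≤k with emit a q in e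
  ... | nothing = schreier-bounded w (next a q) (next-≤ a q≤k)
  ... | just u = emit-bounded a q≤k e ∷ schreier-bounded w (next a q) (next-≤ a q≤k)

  coset-≤ : ∀ w q → q ≤ k → coset q w ≤ k
  coset-≤ [] q q≤k = q≤k
  coset-≤ (a ∷ w) q q≤k = coset-≤ w (next a q) (next-≤ a q≤k)

  σ-run : ∀ r → schreier r (replicate r (σ , true)) ≡ [] × coset r (replicate r (σ , true)) ≡ 0
  σ-run zero = refl , refl
  σ-run (suc r) = σ-run r

  σ⁻¹-run : ∀ r j w → j + r ≤ k →
            schreier j (replicate r (σ , false) ++ w) ≡ schreier (j + r) w
            × coset j (replicate r (σ , false) ++ w) ≡ coset (j + r) w
  σ⁻¹-run zero j w _ rewrite +-identityʳ j = refl , refl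
  σ⁻¹-run (suc r) j w j+r<k rewrite +-suc j r | incr-< (m+n≤o⇒m≤o (suc j) j+r<k) =
    σ⁻¹-run r (suc j) w j+r<k

  γ-trace : ∀ (i : Fin (suc (suc k))) → let w = γW (suc (suc k)) (toℕ i) in
            schreier 0 w ≡ (toℕ i , true) ∷ [] × coset 0 w ≡ 0
  γ-trace zero = cong ((0 , true) ∷_) (proj₁ (σ-run k)) , proj₂ (σ-run k)
  γ-trace (suc zero) = cong ((1 , true) ∷_) (proj₁ (σ-run k)) , proj₂ (σ-run k)
  γ-trace (suc (suc i)) =
    trans (proj₁ run) (cong ((suc (suc m) , true) ∷_) (proj₁ (σ-run m))) ,
    trans (proj₂ run) (proj₂ (σ-run m))
    where
    m = toℕ i
    run = σ⁻¹-run (suc m) 0 ((τ , true) ∷ replicate m (σ , true)) (toℕ<n i)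

  inverse-trace : ∀ w {u} → schreier 0 w ≡ u ∷ [] → coset 0 w ≡ 0 →
                  schreier 0 (inverseWord w) ≡ (u H.⁻¹) ∷ [] × coset 0 (inverseWord w) ≡ 0
  inverse-trace w s c =
    trans (cong (λ j → schreier j (inverseWord w)) (sym c))
          (trans (schreier-inverseWord w 0 z≤n) (cong H.inverseWord s)) ,
    trans (cong (λ j → coset j (inverseWord w)) (sym c)) (coset-inverseWord w 0 z≤n)

  basisLabel : List Letter → H.Sym
  basisLabel w = H.label (suc (coset 0 w)) (schreier 0 w)

  basisLabel-bounded : ∀ w → Bounded (basisLabel w)
  basisLabel-bounded w = H.label-All _ _ (s≤s (coset-≤ w 0 z≤n)) (schreier-bounded w 0 z≤n)

  basisLabel-reduceOnto : ∀ w {u} y → schreier 0 w ≡ u ∷ [] → coset 0 w ≡ 0 → Reduced y →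
                          basisLabel (reduceOnto w y) ≡ H.label (suc (coset 0 y)) (H.cons u (schreier 0 y))
  basisLabel-reduceOnto w y s c r = cong₂ H.label
    (cong suc (trans (coset-reduceOnto w 0 y z≤n) (cong (λ j → coset j y) c)))
    (trans (schreier-reduceOnto w 0 y z≤n r) (cong₂ H.reduceOnto s (cong (λ j → schreier j y) c)))

  labelling : F₂ → Fin (suc (suc k)) × Bool
  labelling x = map₁ (clamp (suc k)) (basisLabel (proj₁ x))

  labelling-≡ : ∀ x i b → labelling x ≡ (i , b) ⇔ basisLabel (proj₁ x) ≡ (toℕ i , b)
  labelling-≡ x i b = mk⇔ to from
    where
    to : labelling x ≡ (i , b) → basisLabel (proj₁ x) ≡ (toℕ i , b)
    to e with basisLabel (proj₁ x) | basisLabel-bounded (proj₁ x)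
    ... | c , b′ | c≤ with e
    ...   | refl = cong (_, b′) (sym (toℕ-clamp (suc k) c c≤))
    from : basisLabel (proj₁ x) ≡ (toℕ i , b) → labelling x ≡ (i , b)
    from e rewrite e = cong (_, b) (clamp-toℕ (suc k) i)

  σ-power-in-A : ∀ i → InA labelling i (pow σ (+ 1 - + toℕ i))
  σ-power-in-A zero = refl
  σ-power-in-A (suc zero) = refl
  σ-power-in-A (suc (suc i)) =
    Equivalence.from (labelling-≡ ⟦ σ⁻ᵐ ⟧ (suc (suc i)) true) (cong₂ H.label (cong suc c) s)
    where
    m = toℕ i
    σ⁻ᵐ = replicate (suc m) (σ , false)
    word : reduce σ⁻ᵐ ≡ σ⁻ᵐ ++ []
    word = trans (reduce≡normalForm σ⁻ᵐ)
                 (trans (W.normalForm-reduced σ⁻ᵐ (W.replicate-reduced (σ , false) (suc m))) (sym (++-identityʳ σ⁻ᵐ)))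
    run = σ⁻¹-run (suc m) 0 [] (toℕ<n i)
    s = trans (cong (schreier 0) word) (proj₁ run)
    c = trans (cong (coset 0) word) (proj₂ run)

  ω-in-A : ∀ ω → StartsWithτ ω → ∀ i → toℕ i ≡ 1 → InA labelling i ω
  ω-in-A (.((τ , true) ∷ v) , _) (v , refl) (suc zero) _ = refl

  γ⁻¹ : Fin (suc (suc k)) → F₂
  γ⁻¹ i = ⟦ inverseWord (γW (suc (suc k)) (toℕ i)) ⟧

  γ·γ⁻¹· : ∀ i x → γ (suc (suc k)) i · (γ⁻¹ i · x) ≡ x
  γ·γ⁻¹· i x = F₂-ext _ x (begin
    proj₁ (γ (suc (suc k)) i · (γ⁻¹ i · x))  ≡⟨ word-⟦⟧· w (γ⁻¹ i · x) ⟩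
    reduceOnto w (proj₁ (γ⁻¹ i · x))         ≡⟨ cong (reduceOnto w) (word-⟦⟧· (inverseWord w) x) ⟩
    reduceOnto w (reduceOnto (inverseWord w) (proj₁ x))  ≡⟨ W.reduceOnto-inverseWord w (proj₁ x) (reduced x) ⟩
    proj₁ x                                  ∎)
    where
    open ≡-Reasoning
    w = γW (suc (suc k)) (toℕ i)

  basisLabel-γ· : ∀ i y → basisLabel (proj₁ (γ (suc (suc k)) i · y))
                          ≡ H.label (suc (coset 0 (proj₁ y))) (H.cons (toℕ i , true) (schreier 0 (proj₁ y)))
  basisLabel-γ· i y = trans (cong basisLabel (word-⟦⟧· w y)) (basisLabel-reduceOnto w (proj₁ y) s c (reduced y))
    where
    w = γW (suc (suc k)) (toℕ i)
    s = proj₁ (γ-trace i)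
    c = proj₂ (γ-trace i)

  basisLabel-γ⁻¹· : ∀ i y → basisLabel (proj₁ (γ⁻¹ i · y))
                            ≡ H.label (suc (coset 0 (proj₁ y))) (H.cons (toℕ i , false) (schreier 0 (proj₁ y)))
  basisLabel-γ⁻¹· i y =
    trans (cong basisLabel (word-⟦⟧· w⁻¹ y)) (basisLabel-reduceOnto w⁻¹ (proj₁ y) s c (reduced y))
    where
    w = γW (suc (suc k)) (toℕ i)
    w⁻¹ = inverseWord w
    s = proj₁ (inverse-trace w (proj₁ (γ-trace i)) (proj₂ (γ-trace i)))
    c = proj₂ (inverse-trace w (proj₁ (γ-trace i)) (proj₂ (γ-trace i)))

  γ-ping-pong : ∀ i x → InImage (γ (suc (suc k)) i) (InB labelling i) x ⇔ (¬ InA labelling i x)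
  γ-ping-pong i x = mk⇔ to from
    where
    to : InImage (γ (suc (suc k)) i) (InB labelling i) x → ¬ InA labelling i x
    to (b , b∈B , refl) x∈A = H.label-cons⁺ _ (schreier 0 (proj₁ b)) (toℕ i)
      (schreier-reduced 0 (proj₁ b) z≤n (reduced b))
      (Equivalence.to (labelling-≡ b i false) b∈B)
      (trans (sym (basisLabel-γ· i b)) (Equivalence.to (labelling-≡ x i true) x∈A))
    from : ¬ InA labelling i x → InImage (γ (suc (suc k)) i) (InB labelling i) x
    from x∉A = γ⁻¹ i · x , b∈B , γ·γ⁻¹· i x
      where
      b∈B : InB labelling i (γ⁻¹ i · x)
      b∈B = Equivalence.from (labelling-≡ (γ⁻¹ i · x) i false)
        (trans (basisLabel-γ⁻¹· i x)
               (H.label-cons⁻ _ (schreier 0 (proj₁ x)) (toℕ i) (x∉A ∘ Equivalence.from (labelling-≡ x i true))))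

lemma2p6 : (n : ℕ) → 2 ≤ n → (ω : F₂) → StartsWithτ ω →
    Σ (F₂ → Fin n × Bool) (λ p →
      ((i : Fin n) → InA p i (pow σ (+ 1 - + toℕ i)))
      × ((i : Fin n) → toℕ i ≡ 1 → InA p i ω)
      × ((i : Fin n) (x : F₂) → InImage (γ n i) (InB p i) x ⇔ (¬ InA p i x)))
lemma2p6 (suc (suc k)) (s≤s (s≤s z≤n)) ω ω-τ = labelling , σ-power-in-A , ω-in-A ω ω-τ , γ-ping-pong
  where open Schreier k
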